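{- Let $G$ be a graph or a digraph and let $H$ be a da-hypomorph of $G$. Then $G\cong H$ if and only if $G$ has a pair of dacards $(A,\mathrm{dt}(A))$, $(B,\mathrm{dt}(B))$, obtained by deleting two distinct vertices of $G$, which is dapasted isomorphically in $G$ and $H$.
   Context: Digraphs are finite, without loops or multiple arcs; for distinct vertices $x,y$ both $xy$ and $yx$ may be arcs (together a biarc); an arc whose reverse is absent is an unpaired arc. A graph is regarded as a digraph in which every edge is a biarc. For a vertex $x$ of a digraph $D$, a vertex $w$ is an out-neighbor (in-neighbor) of $x$ if $xw$ ($wx$) is an unpaired arc, and a strong neighbor if $xw,wx$ are both arcs. The degree triple $\mathrm{dt}_D(x)=(a,b,c)$ consists of the numbers of out-, in- and strong neighbors of $x$ (for a graph it encodes the degree). A dacard of $D$ is a pair $(D-x,\mathrm{dt}_D(x))$ with $D-x$ taken up to isomorphism; two dacards are identical if the digraphs are isomorphic and the triples are equal. $\mathrm{Dadeck}(D)$ is the multiset of dacards of $D$ over all vertices; $D$ and $H$ are da-hypomorphs if they have the same dadeck. Dapasting: let $(A,\alpha)$, $(B,\beta)$ be dacards of $G$ obtained by deleting distinct vertices of $G$. A dapasting of them as members of $\mathrm{Dadeck}(G)$ is a digraph $P$ with two distinct non-adjacent vertices $u,v$, $u$ labeled $(e,\alpha)$ and $v$ labeled $(e,\beta)$ (all other vertices unlabeled), such that $P-u\cong A$, $P-v\cong B$, and there is $Y\in\{P,P+uv,P+vu,P+uv+vu\}$ ($P+xy$ = $P$ with arc $xy$ added) with $\mathrm{dt}_Y(u)=\alpha$,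 $\mathrm{dt}_Y(v)=\beta$ and $Y$ da-hypomorphic to $G$; any digraph isomorphic to such a $Y$ is a completion of $P$, and $u,v$ are the external vertices. $P$ is a dapasting in a digraph $J$ if $J$ is a completion of $P$. Two dapastings are isomorphic if there is a digraph isomorphism between them sending each vertex to a vertex with the same label (unlabeled to unlabeled). If $H$ is a da-hypomorph of $G$, the dacards $A,B$ are dapasted isomorphically in $G$ and $H$ if there exist a dapasting $P_1$ of $A,B$ (as members of $\mathrm{Dadeck}(G)$) in $G$ and a dapasting $P_2$ of $A,B$ (as members of $\mathrm{Dadeck}(G)$) in $H$ which are isomorphic as dapastings. -}

module Defs where

open import Data.Nat using (ℕ; zero; suc; _+_)
open import Data.Bool using (Bool; true; false; _∧_; _∨_; not; if_then_else_)
open import Data.Fin using (Fin; zero; suc; punchIn; _≟_)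
open import Data.Product using (Σ; _×_; _,_)
open import Data.Maybe using (Maybe; just; nothing)
open import Data.Empty using (⊥-elim)
open import Function using (_∘_)
open import Function.Bundles using (_↔_; Inverse)
open import Relation.Nullary using (yes; no; ¬_)
open import Relation.Nullary.Decidable using (⌊_⌋)
open import Relation.Binary.PropositionalEquality using (_≡_; _≢_; refl)

-- A (finite, loopless) digraph on the vertex set Fin n.
-- A graph is the special case in which arc is symmetric.
record Digraph (n : ℕ) : Set where
  field
    arc      : Fin n → Fin n → Bool
    loopless : ∀ x → arc x x ≡ false
open Digraph public

_≅_ : ∀ {n} → Digraph n → Digraph n → Set
_≅_ {n} D H = Σ (Fin n ↔ Fin n) λ f →
  ∀ x y → arc D x y ≡ arc H (Inverse.to f x) (Inverse.to f y)

delete : ∀ {n} → Digraph (suc n) → Fin (suc n) → Digraph n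
delete D x = record
  { arc = λ i j → arc D (punchIn x i) (punchIn x j)
  ; loopless = λ i → loopless D (punchIn x i) }

count : ∀ {n} → (Fin n → Bool) → ℕ
count {zero}  p = 0
count {suc n} p = (if p zero then 1 else 0) + count (p ∘ suc)

DT : Set
DT = ℕ × ℕ × ℕ

dt : ∀ {n} → Digraph n → Fin n → DT
dt D x =
    count (λ w → arc D x w ∧ not (arc D w x))
  , count (λ w → arc D w x ∧ not (arc D x w))
  , count (λ w → arc D x w ∧ arc D w x)

-- Equality of dadecks (as multisets): a bijection σ of vertices matching
-- dacards, i.e. G - x ≅ H - σ x and dt_G(x) = dt_H(σ x).
DaHypomorphic : ∀ {n} → Digraph (suc n) → Digraph (suc n) → Set
DaHypomorphic {n} G H = Σ (Fin (suc n) ↔ Fin (suc n)) λ σ →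
  ∀ x → (delete G x ≅ delete H (Inverse.to σ x)) × (dt G x ≡ dt H (Inverse.to σ x))

eqb : ∀ {n} → Fin n → Fin n → Bool
eqb i j = ⌊ i ≟ j ⌋

eqb-refl : ∀ {n} (x : Fin n) → eqb x x ≡ true
eqb-refl x with x ≟ x
... | yes _ = refl
... | no ¬p = ⊥-elim (¬p refl)

-- P with (optionally) the arc uv (if b₁) and the arc vu (if b₂) added.
-- The factor 'not (eqb i j)' only guards against loops (irrelevant when u ≢ v).
addArcs : ∀ {n} → Digraph n → Fin n → Fin n → Bool → Bool → Digraph n
addArcs P u v b₁ b₂ = record
  { arc = λ i j → arc P i j ∨
        (not (eqb i j) ∧ ((b₁ ∧ (eqb i u ∧ eqb j v)) ∨ (b₂ ∧ (eqb i v ∧ eqb j u))))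
  ; loopless = lem }
  where
  lem : ∀ x → (arc P x x ∨ (not (eqb x x) ∧ _)) ≡ false
  lem x rewrite loopless P x | eqb-refl x = refl

-- A dapasting of the dacards (A, α), (B, β) as members of Dadeck(G),
-- which is a dapasting in J (i.e. J is a completion of it).
record Dapasting {n : ℕ} (G : Digraph (suc (suc n))) (A B : Digraph (suc n))
                 (α β : DT) (J : Digraph (suc (suc n))) : Set where
  field
    P      : Digraph (suc (suc n))
    u v    : Fin (suc (suc n))
    u≢v    : u ≢ v
    nonadj : (arc P u v ≡ false) × (arc P v u ≡ false)
    delU   : delete P u ≅ A
    delV   : delete P v ≅ B
    -- Y = addArcs P u v b₁ b₂ ranges over {P, P+uv, P+vu, P+uv+vu}
    b₁ b₂  : Bool
    dtU    : dt (addArcs P u v b₁ b₂) u ≡ α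
    dtV    : dt (addArcs P u v b₁ b₂) v ≡ β
    hyp    : DaHypomorphic (addArcs P u v b₁ b₂) G
    compl  : J ≅ addArcs P u v b₁ b₂

  label : Fin (suc (suc n)) → Maybe DT
  label w = if eqb w u then just α else (if eqb w v then just β else nothing)
open Dapasting public

DapastingIso : ∀ {n} {G : Digraph (suc (suc n))} {A B : Digraph (suc n)} {α β : DT}
  {J₁ J₂ : Digraph (suc (suc n))} →
  Dapasting G A B α β J₁ → Dapasting G A B α β J₂ → Set
DapastingIso {n} d₁ d₂ = Σ (Fin (suc (suc n)) ↔ Fin (suc (suc n))) λ φ →
    (∀ x y → arc (P d₁) x y ≡ arc (P d₂) (Inverse.to φ x) (Inverse.to φ y))
  × (∀ w → label d₂ (Inverse.to φ w) ≡ label d₁ w)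

DapastedIsomorphically : ∀ {n} → (G H : Digraph (suc (suc n))) →
  Fin (suc (suc n)) → Fin (suc (suc n)) → Set
DapastedIsomorphically G H a b =
  Σ (Dapasting G (delete G a) (delete G b) (dt G a) (dt G b) G) λ P₁ →
  Σ (Dapasting G (delete G a) (delete G b) (dt G a) (dt G b) H) λ P₂ →
  DapastingIso P₁ P₂

{-# OPTIONS --safe #-}
-- An isomorphism of dapastings P₁ ≅ P₂ sends the external vertices of P₁ to
-- external vertices of P₂ carrying the same labels.  In a completion Y of P
-- the degree triple of an external vertex u is its triple in P plus the
-- contribution of the arcs added between u and v, and this contribution
-- determines which of uv, vu were added.  So both completions add the same
-- arcs, the isomorphism extends to them, and G ≅ Y₁ ≅ Y₂ ≅ H.  Conversely,
-- if G ≅ H then deleting the arcs between two vertices of G gives a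
-- dapasting which lies in G and in H alike.
module Submission where

open import Defs
open import Data.Nat using (ℕ; zero; suc; _+_; _≡ᵇ_)
open import Data.Nat.Properties using (+-cancelʳ-≡; +-0-commutativeMonoid)
open import Data.Bool using (Bool; true; false; _∧_; _∨_; not; if_then_else_)
open import Data.Bool.Properties using (∧-zeroʳ; ∧-identityʳ; ∨-identityʳ; ∨-zeroʳ; ∨-comm)
open import Data.Fin using (Fin; zero; suc; _≟_; punchIn)
open import Data.Fin.Properties using (punchInᵢ≢i)
open import Data.Product using (Σ; _×_; _,_; proj₁; proj₂)
open import Data.Product.Properties using (≡-dec)
open import Data.Sum using (_⊎_; inj₁; inj₂)
open import Data.Maybe using (just)
open import Data.Maybe.Properties using (just-injective)
open import Data.Empty using (⊥-elim)
open import Function using (_∘_)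
open import Function.Bundles using (_⇔_; _↔_; Inverse; Injection; mk⇔)
open import Function.Properties.Inverse using (↔-refl; ↔-sym; ↔-trans; ↔⇒↣)
open import Relation.Nullary using (yes; no)
open import Relation.Binary.PropositionalEquality
open import Algebra.Properties.CommutativeMonoid.Sum +-0-commutativeMonoid
  using (sum; sum-cong-≗; sum-permute; sum-remove)

open Inverse using (to)
open ≡-Reasoning

SameArcs : ∀ {n} → Digraph n → Digraph n → Set
SameArcs D H = ∀ x y → arc D x y ≡ arc H x y

NonAdjacent : ∀ {n} → Digraph n → Fin n → Fin n → Set
NonAdjacent P u v = (arc P u v ≡ false) × (arc P v u ≡ false)

SameArcs⇒≅ : ∀ {n} {D H : Digraph n} → SameArcs D H → D ≅ H
SameArcs⇒≅ e = ↔-refl , e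

≅-refl : ∀ {n} {D : Digraph n} → D ≅ D
≅-refl = ↔-refl , λ _ _ → refl

≅-sym : ∀ {n} {D H : Digraph n} → D ≅ H → H ≅ D
≅-sym {D = D} {H} (φ , e) = ↔-sym φ , λ x y → sym (begin
  arc D (from x) (from y)        ≡⟨ e (from x) (from y) ⟩
  arc H (to φ (from x)) (to φ (from y))
    ≡⟨ cong₂ (arc H) (Inverse.strictlyInverseˡ φ x) (Inverse.strictlyInverseˡ φ y) ⟩
  arc H x y                      ∎)
  where from = Inverse.from φ

≅-trans : ∀ {n} {D H K : Digraph n} → D ≅ H → H ≅ K → D ≅ K
≅-trans (φ , e) (ψ , e′) = ↔-trans φ ψ , λ x y → trans (e x y) (e′ _ _)

to-injective : ∀ {n} (φ : Fin n ↔ Fin n) {x y} → to φ x ≡ to φ y → x ≡ y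
to-injective φ = Injection.injective (↔⇒↣ φ)

eqb-false : ∀ {n} {x y : Fin n} → x ≢ y → eqb x y ≡ false
eqb-false {x = x} {y} x≢y with x ≟ y
... | yes x≡y = ⊥-elim (x≢y x≡y)
... | no _    = refl

eqb-to : ∀ {n} (φ : Fin n ↔ Fin n) x y → eqb (to φ x) (to φ y) ≡ eqb x y
eqb-to φ x y with x ≟ y
... | yes refl = eqb-refl (to φ x)
... | no x≢y   = eqb-false (x≢y ∘ to-injective φ)

eqb-pair-false : ∀ {n} {x y u v : Fin n} → (x , y) ≢ (u , v) → eqb x u ∧ eqb y v ≡ false
eqb-pair-false {x = x} {y} {u} {v} ne with x ≟ u
... | yes refl = eqb-false (ne ∘ cong (x ,_))
... | no _     = refl

ind : Bool → ℕ
ind b = if b then 1 else 0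

count≡sum : ∀ {m} (p : Fin m → Bool) → count p ≡ sum (ind ∘ p)
count≡sum {zero}  p = refl
count≡sum {suc m} p = cong (ind (p zero) +_) (count≡sum (p ∘ suc))

count-cong : ∀ {m} {p q : Fin m → Bool} → p ≗ q → count p ≡ count q
count-cong {p = p} {q} p≗q = begin
  count p          ≡⟨ count≡sum p ⟩
  sum (ind ∘ p)    ≡⟨ sum-cong-≗ (cong ind ∘ p≗q) ⟩
  sum (ind ∘ q)    ≡⟨ count≡sum q ⟨
  count q          ∎

count-permute : ∀ {m} (φ : Fin m ↔ Fin m) (q : Fin m → Bool) → count (q ∘ to φ) ≡ count q
count-permute φ q = begin
  count (q ∘ to φ)        ≡⟨ count≡sum (q ∘ to φ) ⟩
  sum (ind ∘ q ∘ to φ)    ≡⟨ sum-permute (ind ∘ q) φ ⟨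
  sum (ind ∘ q)           ≡⟨ count≡sum q ⟨
  count q                 ∎

count-remove : ∀ {m} (p : Fin (suc m) → Bool) v → count p ≡ ind (p v) + count (p ∘ punchIn v)
count-remove p v = begin
  count p                                  ≡⟨ count≡sum p ⟩
  sum (ind ∘ p)                            ≡⟨ sum-remove {i = v} (ind ∘ p) ⟩
  ind (p v) + sum (ind ∘ p ∘ punchIn v)    ≡⟨ cong (ind (p v) +_) (count≡sum (p ∘ punchIn v)) ⟨
  ind (p v) + count (p ∘ punchIn v)        ∎

relCount : ∀ {n} → Digraph n → (Bool → Bool → Bool) → Fin n → ℕ
relCount D g x = count (λ w → g (arc D x w) (arc D w x))

dt-≅ : ∀ {n} {D H : Digraph n} ((φ , _) : D ≅ H) x → dt D x ≡ dt H (to φ x)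
dt-≅ {D = D} {H} (φ , e) x =
  cong₂ _,_ (relCount-≅ λ a b → a ∧ not b)
    (cong₂ _,_ (relCount-≅ λ a b → b ∧ not a) (relCount-≅ _∧_))
  where
  relCount-≅ : ∀ g → relCount D g x ≡ relCount H g (to φ x)
  relCount-≅ g = trans (count-cong λ w → cong₂ g (e x w) (e w x))
                       (count-permute φ λ w → g (arc H (to φ x) w) (arc H w (to φ x)))

_⊕_ : DT → DT → DT
(a , b , c) ⊕ (a′ , b′ , c′) = a + a′ , b + b′ , c + c′

⊕-cancelʳ : ∀ s s′ t → s ⊕ t ≡ s′ ⊕ t → s ≡ s′
⊕-cancelʳ (a , b , c) (a′ , b′ , c′) (x , y , z) eq =
  cong₂ _,_ (+-cancelʳ-≡ x a a′ (cong proj₁ eq))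
    (cong₂ _,_ (+-cancelʳ-≡ y b b′ (cong (proj₁ ∘ proj₂) eq))
               (+-cancelʳ-≡ z c c′ (cong (proj₂ ∘ proj₂) eq)))

-- The change of the degree triple of u when the arcs uv (if c₁) and vu
-- (if c₂) are added between non-adjacent u, v.
link : Bool → Bool → DT
link c₁ c₂ = ind (c₁ ∧ not c₂) , ind (c₂ ∧ not c₁) , ind (c₁ ∧ c₂)

unlink : DT → Bool × Bool
unlink (a , b , c) = not (a + c ≡ᵇ 0) , not (b + c ≡ᵇ 0)

unlink-link : ∀ c₁ c₂ → unlink (link c₁ c₂) ≡ (c₁ , c₂)
unlink-link false false = refl
unlink-link false true  = refl
unlink-link true  false = refl
unlink-link true  true  = refl

link-injective : ∀ {c₁ c₂ e₁ e₂} → link c₁ c₂ ≡ link e₁ e₂ → (c₁ , c₂) ≡ (e₁ , e₂)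
link-injective {c₁} {c₂} {e₁} {e₂} eq = begin
  (c₁ , c₂)              ≡⟨ unlink-link c₁ c₂ ⟨
  unlink (link c₁ c₂)    ≡⟨ cong unlink eq ⟩
  unlink (link e₁ e₂)    ≡⟨ unlink-link e₁ e₂ ⟩
  (e₁ , e₂)              ∎

module _ {n} (P : Digraph n) {u v : Fin n} (c₁ c₂ : Bool) where

  addArcs-away : ∀ {x y} → (x , y) ≢ (u , v) → (x , y) ≢ (v , u) →
                 arc (addArcs P u v c₁ c₂) x y ≡ arc P x y
  addArcs-away {x} {y} ne₁ ne₂
    rewrite eqb-pair-false ne₁ | eqb-pair-false ne₂ | ∧-zeroʳ c₁ | ∧-zeroʳ c₂
          | ∧-zeroʳ (not (eqb x y)) = ∨-identityʳ (arc P x y)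

  addArcs-uv : u ≢ v → arc P u v ≡ false → arc (addArcs P u v c₁ c₂) u v ≡ c₁
  addArcs-uv u≢v na
    rewrite na | eqb-false u≢v | eqb-refl u | eqb-refl v | ∧-identityʳ c₁ | ∧-zeroʳ c₂ =
    ∨-identityʳ c₁

  addArcs-vu : u ≢ v → arc P v u ≡ false → arc (addArcs P u v c₁ c₂) v u ≡ c₂
  addArcs-vu u≢v na
    rewrite na | eqb-false (u≢v ∘ sym) | eqb-refl u | eqb-refl v | ∧-zeroʳ c₁
          | ∧-identityʳ c₂ = refl

dt-addArcs : ∀ {n} (P : Digraph (suc n)) {u v} c₁ c₂ → u ≢ v → NonAdjacent P u v →
             dt (addArcs P u v c₁ c₂) u ≡ link c₁ c₂ ⊕ dt P u
dt-addArcs {n} P {u} {v} c₁ c₂ u≢v (na₁ , na₂) =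
  cong₂ _,_ (relCount-addArcs (λ a b → a ∧ not b) refl)
    (cong₂ _,_ (relCount-addArcs (λ a b → b ∧ not a) refl) (relCount-addArcs _∧_ refl))
  where
  Y = addArcs P u v c₁ c₂

  relCount-addArcs : ∀ g → g false false ≡ false →
                     relCount Y g u ≡ ind (g c₁ c₂) + relCount P g u
  relCount-addArcs g g00 = begin
    count fY                                 ≡⟨ count-remove fY v ⟩
    ind (fY v) + count (fY ∘ punchIn v)      ≡⟨ cong₂ _+_ (cong ind fY-v) (count-cong off-v) ⟩
    ind (g c₁ c₂) + count (fP ∘ punchIn v)   ≡⟨ cong (ind (g c₁ c₂) +_) count-fP ⟨
    ind (g c₁ c₂) + count fP                 ∎
    where
    fY fP : Fin (suc n) → Bool
    fY w = g (arc Y u w) (arc Y w u)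
    fP w = g (arc P u w) (arc P w u)
    fY-v : fY v ≡ g c₁ c₂
    fY-v = cong₂ g (addArcs-uv P c₁ c₂ u≢v na₁) (addArcs-vu P c₁ c₂ u≢v na₂)
    count-fP : count fP ≡ count (fP ∘ punchIn v)
    count-fP = trans (count-remove fP v)
                     (cong (λ b → ind b + count (fP ∘ punchIn v)) (trans (cong₂ g na₁ na₂) g00))
    off-v : ∀ w → fY (punchIn v w) ≡ fP (punchIn v w)
    off-v w = cong₂ g (addArcs-away P c₁ c₂ (w≢v ∘ cong proj₂) (u≢v ∘ cong proj₁))
                      (addArcs-away P c₁ c₂ (u≢v ∘ cong proj₂) (w≢v ∘ cong proj₁))
      where w≢v = punchInᵢ≢i v w

addArcs-swap : ∀ {n} (P : Digraph n) u v c₁ c₂ →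
               SameArcs (addArcs P u v c₁ c₂) (addArcs P v u c₂ c₁)
addArcs-swap P u v c₁ c₂ x y = cong (λ z → arc P x y ∨ (not (eqb x y) ∧ z))
  (∨-comm (c₁ ∧ (eqb x u ∧ eqb y v)) (c₂ ∧ (eqb x v ∧ eqb y u)))

addArcs-≅ : ∀ {n} {P₁ P₂ : Digraph n} ((φ , _) : P₁ ≅ P₂) u v c₁ c₂ →
            addArcs P₁ u v c₁ c₂ ≅ addArcs P₂ (to φ u) (to φ v) c₁ c₂
addArcs-≅ {P₁ = P₁} {P₂} (φ , e) u v c₁ c₂ = φ , arcs
  where
  arcs : ∀ x y → arc (addArcs P₁ u v c₁ c₂) x y
               ≡ arc (addArcs P₂ (to φ u) (to φ v) c₁ c₂) (to φ x) (to φ y)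
  arcs x y rewrite e x y | eqb-to φ x y | eqb-to φ x u | eqb-to φ y v
                 | eqb-to φ x v | eqb-to φ y u = refl

completion-≅ : ∀ {n} {P₁ P₂ : Digraph (suc n)} (iso : P₁ ≅ P₂) {u₁ v₁ u₂ v₂}
  c₁ c₂ e₁ e₂ →
  u₁ ≢ v₁ → NonAdjacent P₁ u₁ v₁ →
  to (proj₁ iso) u₁ ≡ u₂ → to (proj₁ iso) v₁ ≡ v₂ →
  dt (addArcs P₁ u₁ v₁ c₁ c₂) u₁ ≡ dt (addArcs P₂ u₂ v₂ e₁ e₂) u₂ →
  addArcs P₁ u₁ v₁ c₁ c₂ ≅ addArcs P₂ u₂ v₂ e₁ e₂
completion-≅ {P₁ = P₁} {P₂} iso@(φ , e) {u₁} {v₁} c₁ c₂ e₁ e₂ u₁≢v₁ (na₁ , na₂) refl refl dt≡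
  with link-injective {c₁} {c₂} {e₁} {e₂} (⊕-cancelʳ _ _ (dt P₂ (to φ u₁)) links)
  where
  links : link c₁ c₂ ⊕ dt P₂ (to φ u₁) ≡ link e₁ e₂ ⊕ dt P₂ (to φ u₁)
  links = begin
    link c₁ c₂ ⊕ dt P₂ (to φ u₁)   ≡⟨ cong (link c₁ c₂ ⊕_) (dt-≅ {D = P₁} {P₂} iso u₁) ⟨
    link c₁ c₂ ⊕ dt P₁ u₁          ≡⟨ dt-addArcs P₁ c₁ c₂ u₁≢v₁ (na₁ , na₂) ⟨
    dt (addArcs P₁ u₁ v₁ c₁ c₂) u₁ ≡⟨ dt≡ ⟩
    dt (addArcs P₂ (to φ u₁) (to φ v₁) e₁ e₂) (to φ u₁)
      ≡⟨ dt-addArcs P₂ e₁ e₂ (u₁≢v₁ ∘ to-injective φ)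
                    (trans (sym (e u₁ v₁)) na₁ , trans (sym (e v₁ u₁)) na₂) ⟩
    link e₁ e₂ ⊕ dt P₂ (to φ u₁)   ∎
... | refl = addArcs-≅ {P₁ = P₁} {P₂} iso u₁ v₁ c₁ c₂

module _ {n} {G : Digraph (suc (suc n))} {A B : Digraph (suc n)} {α β : DT} where

  Completion : ∀ {J} → Dapasting G A B α β J → Digraph (suc (suc n))
  Completion d = addArcs (P d) (u d) (v d) (b₁ d) (b₂ d)

  label-u : ∀ {J} (d : Dapasting G A B α β J) → label d (u d) ≡ just α
  label-u d rewrite eqb-refl (u d) = refl

  label-v : ∀ {J} (d : Dapasting G A B α β J) → label d (v d) ≡ just β
  label-v d rewrite eqb-false (u≢v d ∘ sym) | eqb-refl (v d) = refl

  label-just : ∀ {J} (d : Dapasting G A B α β J) {w γ} → label d w ≡ just γ →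
               (w ≡ u d × α ≡ γ) ⊎ (w ≡ v d × β ≡ γ)
  label-just d {w} eq with w ≟ u d
  ... | yes w≡u = inj₁ (w≡u , just-injective eq)
  ... | no _ with w ≟ v d
  ...   | yes w≡v = inj₂ (w≡v , just-injective eq)
  label-just d () | no _ | no _

  external-images : ∀ {J₁ J₂} (d₁ : Dapasting G A B α β J₁) (d₂ : Dapasting G A B α β J₂)
    ((φ , _) : DapastingIso d₁ d₂) →
      (to φ (u d₁) ≡ u d₂ × to φ (v d₁) ≡ v d₂)
    ⊎ (to φ (u d₁) ≡ v d₂ × to φ (v d₁) ≡ u d₂ × α ≡ β)
  external-images d₁ d₂ (φ , _ , lab)
    with label-just d₂ (trans (lab (u d₁)) (label-u d₁))
       | label-just d₂ (trans (lab (v d₁)) (label-v d₁))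
  ... | inj₁ (φu , _)   | inj₂ (φv , _) = inj₁ (φu , φv)
  ... | inj₂ (φu , β≡α) | inj₁ (φv , _) = inj₂ (φu , φv , sym β≡α)
  ... | inj₁ (φu , _)   | inj₁ (φv , _) = ⊥-elim (u≢v d₁ (to-injective φ (trans φu (sym φv))))
  ... | inj₂ (φu , _)   | inj₂ (φv , _) = ⊥-elim (u≢v d₁ (to-injective φ (trans φu (sym φv))))

  completions-≅ : ∀ {J₁ J₂} (d₁ : Dapasting G A B α β J₁) (d₂ : Dapasting G A B α β J₂) →
                  DapastingIso d₁ d₂ → Completion d₁ ≅ Completion d₂
  completions-≅ d₁ d₂ iso@(φ , e , _) with external-images d₁ d₂ iso
  ... | inj₁ (φu , φv) =
    completion-≅ {P₁ = P d₁} {P d₂} (φ , e) (b₁ d₁) (b₂ d₁) (b₁ d₂) (b₂ d₂)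
      (u≢v d₁) (nonadj d₁) φu φv (trans (dtU d₁) (sym (dtU d₂)))
  ... | inj₂ (φu , φv , α≡β) =
    ≅-trans {D = Completion d₁} {swapped} {Completion d₂}
      (completion-≅ {P₁ = P d₁} {P d₂} (φ , e) (b₁ d₁) (b₂ d₁) (b₂ d₂) (b₁ d₂)
        (u≢v d₁) (nonadj d₁) φu φv (begin
        dt (Completion d₁) (u d₁)  ≡⟨ dtU d₁ ⟩
        α                          ≡⟨ α≡β ⟩
        β                          ≡⟨ dtV d₂ ⟨
        dt (Completion d₂) (v d₂)
          ≡⟨ dt-≅ {D = swapped} {Completion d₂} swapped≅ (v d₂) ⟨
        dt swapped (v d₂)          ∎))
      swapped≅
    where
    swapped : Digraph (suc (suc n))
    swapped = addArcs (P d₂) (v d₂) (u d₂) (b₂ d₂) (b₁ d₂)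
    swapped≅ : swapped ≅ Completion d₂
    swapped≅ = SameArcs⇒≅ {D = swapped} {Completion d₂} λ x y →
                 sym (addArcs-swap (P d₂) (u d₂) (v d₂) (b₁ d₂) (b₂ d₂) x y)

  dapastingIso⇒≅ : ∀ {H} (d₁ : Dapasting G A B α β G) (d₂ : Dapasting G A B α β H) →
                   DapastingIso d₁ d₂ → G ≅ H
  dapastingIso⇒≅ {H} d₁ d₂ iso =
    ≅-trans {D = G} {Completion d₁} {H} (compl d₁)
      (≅-trans {D = Completion d₁} {Completion d₂} {H} (completions-≅ d₁ d₂ iso)
               (≅-sym {D = H} {Completion d₂} (compl d₂)))

removeArcs : ∀ {n} → Digraph n → Fin n → Fin n → Digraph n
removeArcs D u v = record
  { arc      = λ x y → arc D x y ∧ not ((eqb x u ∧ eqb y v) ∨ (eqb x v ∧ eqb y u))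
  ; loopless = λ x → cong (λ a → a ∧ _) (loopless D x) }

module _ {n} (D : Digraph n) {u v : Fin n} where

  removeArcs-away : ∀ {x y} → (x , y) ≢ (u , v) → (x , y) ≢ (v , u) →
                    arc (removeArcs D u v) x y ≡ arc D x y
  removeArcs-away {x} {y} ne₁ ne₂
    rewrite eqb-pair-false ne₁ | eqb-pair-false ne₂ = ∧-identityʳ (arc D x y)

  removeArcs-nonAdjacent : NonAdjacent (removeArcs D u v) u v
  removeArcs-nonAdjacent
    rewrite eqb-refl u | eqb-refl v | ∨-zeroʳ (eqb v u ∧ eqb u v) =
    ∧-zeroʳ (arc D u v) , ∧-zeroʳ (arc D v u)

  addArcs-removeArcs : u ≢ v →
    SameArcs (addArcs (removeArcs D u v) u v (arc D u v) (arc D v u)) D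
  addArcs-removeArcs u≢v x y
    with ≡-dec _≟_ _≟_ (x , y) (u , v) | ≡-dec _≟_ _≟_ (x , y) (v , u)
  ... | yes refl | _        =
    addArcs-uv (removeArcs D u v) (arc D u v) (arc D v u) u≢v (proj₁ removeArcs-nonAdjacent)
  ... | no _     | yes refl =
    addArcs-vu (removeArcs D u v) (arc D u v) (arc D v u) u≢v (proj₂ removeArcs-nonAdjacent)
  ... | no ne₁   | no ne₂   =
    trans (addArcs-away (removeArcs D u v) (arc D u v) (arc D v u) ne₁ ne₂) (removeArcs-away ne₁ ne₂)

SameArcs⇒DaHypomorphic : ∀ {n} {D H : Digraph (suc n)} → SameArcs D H → DaHypomorphic D H
SameArcs⇒DaHypomorphic {D = D} {H} e = ↔-refl , λ x →
  SameArcs⇒≅ {D = delete D x} {delete H x} (λ i j → e (punchIn x i) (punchIn x j)) ,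
  dt-≅ {D = D} {H} (SameArcs⇒≅ {D = D} {H} e) x

separatingDapasting : ∀ {n} (G : Digraph (suc (suc n))) {a b} → a ≢ b → ∀ {J} → J ≅ G →
  Dapasting G (delete G a) (delete G b) (dt G a) (dt G b) J
separatingDapasting G {a} {b} a≢b {J} J≅G = record
  { P      = removeArcs G a b
  ; u      = a
  ; v      = b
  ; u≢v    = a≢b
  ; nonadj = removeArcs-nonAdjacent G
  ; delU   = SameArcs⇒≅ {D = delete (removeArcs G a b) a} {delete G a} λ i j →
               removeArcs-away G (punchInᵢ≢i a i ∘ cong proj₁) (punchInᵢ≢i a j ∘ cong proj₂)
  ; delV   = SameArcs⇒≅ {D = delete (removeArcs G a b) b} {delete G b} λ i j →
               removeArcs-away G (punchInᵢ≢i b j ∘ cong proj₂) (punchInᵢ≢i b i ∘ cong proj₁)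
  ; b₁     = arc G a b
  ; b₂     = arc G b a
  ; dtU    = dt-≅ {D = Y} {G} Y≅G a
  ; dtV    = dt-≅ {D = Y} {G} Y≅G b
  ; hyp    = SameArcs⇒DaHypomorphic {D = Y} {G} restored
  ; compl  = ≅-trans {D = J} {G} {Y} J≅G (≅-sym {D = Y} {G} Y≅G) }
  where
  Y = addArcs (removeArcs G a b) a b (arc G a b) (arc G b a)
  restored = addArcs-removeArcs G a≢b
  Y≅G = SameArcs⇒≅ {D = Y} {G} restored

≅⇒dapastedIsomorphically : ∀ {n} (G H : Digraph (suc (suc n))) {a b} → a ≢ b → G ≅ H →
  DapastedIsomorphically G H a b
≅⇒dapastedIsomorphically G H a≢b G≅H =
  separatingDapasting G a≢b (≅-refl {D = G}) ,
  separatingDapasting G a≢b (≅-sym {D = G} {H} G≅H) ,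
  ↔-refl , (λ _ _ → refl) , (λ _ → refl)

theorem5p8 : ∀ {n} (G H : Digraph (suc (suc n))) → DaHypomorphic G H →
    (G ≅ H) ⇔ (Σ (Fin (suc (suc n))) λ a → Σ (Fin (suc (suc n))) λ b →
                 (a ≢ b) × DapastedIsomorphically G H a b)
theorem5p8 G H _ = mk⇔
  (λ G≅H → zero , suc zero , 0≢1 , ≅⇒dapastedIsomorphically G H 0≢1 G≅H)
  (λ { (_ , _ , _ , d₁ , d₂ , iso) → dapastingIso⇒≅ d₁ d₂ iso })
  where
  0≢1 : zero ≢ suc zero
  0≢1 ()
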